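{- If the $\nu$ sequence of a numerical semigroup $\Lambda$ is strictly increasing, then $\Lambda=\mathbb{N}_0$.
   Context: A numerical semigroup is a subset $\Lambda\subseteq\mathbb{N}_0$ containing $0$, closed under addition, with finite complement in $\mathbb{N}_0$. The enumeration is the increasing bijection $\lambda:\mathbb{N}_0\to\Lambda$, and $\nu_i=\#\{j\in\mathbb{N}_0:\lambda_i-\lambda_j\in\Lambda\}$. -}

module Defs where

open import Data.Nat using (ℕ; zero; suc; _+_; _∸_; _≤_; _<_; _≤?_)
open import Data.Nat.Properties using ()
open import Data.Product using (Σ; ∃; _×_; _,_)
open import Relation.Nullary using (Dec; yes; no)
open import Relation.Binary.PropositionalEquality using (_≡_)
open import Relation.Nullary.Decidable using (_×-dec_)

record NumericalSemigroup : Set₁ where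
  field
    _∈Λ    : ℕ → Set
    dec    : (n : ℕ) → Dec (n ∈Λ)
    zero∈  : zero ∈Λ
    closed : ∀ m n → m ∈Λ → n ∈Λ → (m + n) ∈Λ
    cofinite : Σ ℕ λ N → ∀ n → N ≤ n → n ∈Λ

record IsEnumeration (S : NumericalSemigroup) (lam : ℕ → ℕ) : Set where
  open NumericalSemigroup S
  field
    strictMono : ∀ i j → i < j → lam i < lam j
    into       : ∀ i → lam i ∈Λ
    onto       : ∀ n → n ∈Λ → Σ ℕ λ i → lam i ≡ n

countBelow : {P : ℕ → Set} → ((j : ℕ) → Dec (P j)) → ℕ → ℕ
countBelow d zero = zero
countBelow d (suc k) with d k
... | yes _ = suc (countBelow d k)
... | no  _ = countBelow d k

-- ν_i = #{ j ∈ ℕ : λ_i - λ_j ∈ Λ }  (difference taken in ℤ, i.e. λ_j ≤ λ_i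
-- and the natural difference lies in Λ).  Since λ is strictly increasing,
-- only j ≤ i can qualify, so counting over j < i + 1 counts the whole set.
nu : (S : NumericalSemigroup) (lam : ℕ → ℕ) → ℕ → ℕ
nu S lam i = countBelow (λ j → (lam j ≤? lam i) ×-dec dec (lam i ∸ lam j)) (suc i)
  where open NumericalSemigroup S

module Submission where

-- Always ν_i ≤ i + 1, since only the indices j ≤ i are
-- counted.  On the other hand ν_0 ≥ 1 (the index 0 is counted, as
-- λ_0 - λ_0 = 0 ∈ Λ), so a strictly increasing ν satisfies ν_i ≥ i + 1.
-- Hence ν_i = i + 1: every j ≤ i is counted, i.e. λ_i - λ_j ∈ Λ.  As λ
-- enumerates Λ, this says that Λ is closed under differences b - a of
-- elements a ≤ b.  Applied to the consecutive elements N ≤ N + 1 of Λ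
-- beyond the conductor bound, it gives 1 ∈ Λ, and closure under addition
-- then yields Λ = ℕ.

open import Defs
open import Data.Nat using (ℕ; zero; suc; _+_; _∸_; _≤_; _<_; _≤?_; z≤n; s≤s)
open import Data.Nat.Properties
  using (≤-refl; ≤-trans; ≤-pred; m≤n⇒m≤1+n; m≤n⇒m<n∨m≡n; <⇒≱; ≰⇒>;
         n∸n≡0; m≤m+n; m+n∸m≡n)
open import Data.Product using (_×_; _,_; proj₁; proj₂)
open import Data.Sum using (inj₁; inj₂)
open import Data.Empty using (⊥-elim)
open import Relation.Nullary using (Dec; yes; no)
open import Relation.Binary.PropositionalEquality using (refl; sym; subst)
open import Relation.Nullary.Decidable using (_×-dec_)

module _ {P : ℕ → Set} (d : (j : ℕ) → Dec (P j)) where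

  countBelow-≤ : ∀ k → countBelow d k ≤ k
  countBelow-≤ zero = z≤n
  countBelow-≤ (suc k) with d k
  ... | yes _ = s≤s (countBelow-≤ k)
  ... | no  _ = m≤n⇒m≤1+n (countBelow-≤ k)

  countBelow-full : ∀ k → k ≤ countBelow d k → ∀ j → j < k → P j
  countBelow-full (suc k) full j j<1+k with d k
  ... | no  _ = ⊥-elim (<⇒≱ full (countBelow-≤ k))
  ... | yes Pk with m≤n⇒m<n∨m≡n (≤-pred j<1+k)
  ...   | inj₁ j<k  = countBelow-full k (≤-pred full) j j<k
  ...   | inj₂ refl = Pk

  countBelow-last : ∀ k → P k → 1 ≤ countBelow d (suc k)
  countBelow-last k Pk with d k
  ... | yes _  = s≤s z≤n
  ... | no ¬Pk = ⊥-elim (¬Pk Pk)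

strictlyIncreasing-≥suc : (f : ℕ → ℕ) → 1 ≤ f 0 → (∀ i → f i < f (suc i)) →
  ∀ i → suc i ≤ f i
strictlyIncreasing-≥suc f f0 inc zero    = f0
strictlyIncreasing-≥suc f f0 inc (suc i) =
  ≤-trans (s≤s (strictlyIncreasing-≥suc f f0 inc i)) (inc i)

module _ (S : NumericalSemigroup) where
  open NumericalSemigroup S

  DifferenceClosed : Set
  DifferenceClosed = ∀ a b → a ∈Λ → b ∈Λ → a ≤ b → (b ∸ a) ∈Λ

  -- A difference-closed numerical semigroup contains 1 (the difference of
  -- N and N + 1, both beyond the cofiniteness bound), hence everything.
  differenceClosed⇒everything : DifferenceClosed → ∀ n → n ∈Λ
  differenceClosed⇒everything diff = all
    where
    N : ℕ
    N = proj₁ cofinite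

    one : 1 ∈Λ
    one = subst _∈Λ (m+n∸m≡n N 1)
      (diff N (N + 1) (proj₂ cofinite N ≤-refl)
            (proj₂ cofinite (N + 1) (m≤m+n N 1)) (m≤m+n N 1))

    all : ∀ n → n ∈Λ
    all zero    = zero∈
    all (suc n) = closed 1 n one (all n)

module _ (S : NumericalSemigroup) (lam : ℕ → ℕ) (E : IsEnumeration S lam) where
  open NumericalSemigroup S
  open IsEnumeration E

  counted? : (i j : ℕ) → Dec ((lam j ≤ lam i) × ((lam i ∸ lam j) ∈Λ))
  counted? i j = (lam j ≤? lam i) ×-dec dec (lam i ∸ lam j)

  nu0-≥1 : 1 ≤ nu S lam 0
  nu0-≥1 = countBelow-last (counted? 0) 0
    (≤-refl , subst _∈Λ (sym (n∸n≡0 (lam 0))) zero∈)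

  lam-reflects-≤ : ∀ i j → lam j ≤ lam i → j ≤ i
  lam-reflects-≤ i j λj≤λi with j ≤? i
  ... | yes j≤i = j≤i
  ... | no  j≰i = ⊥-elim (<⇒≱ (strictMono i j (≰⇒> j≰i)) λj≤λi)

  -- If ν_i attains its maximum i + 1 for every i, then Λ is
  -- difference-closed: b - a is λ_i - λ_j for indices j ≤ i.
  nuMaximal⇒differenceClosed : (∀ i → suc i ≤ nu S lam i) → DifferenceClosed S
  nuMaximal⇒differenceClosed maximal a b a∈ b∈ a≤b
    with onto a a∈ | onto b b∈
  ... | j , refl | i , refl =
    proj₂ (countBelow-full (counted? i) (suc i) (maximal i) j
                           (s≤s (lam-reflects-≤ i j a≤b)))

mainTheorem18 : (S : NumericalSemigroup) (lam : ℕ → ℕ) → IsEnumeration S lam →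
    (∀ i → nu S lam i < nu S lam (suc i)) →
    ∀ n → NumericalSemigroup._∈Λ S n
mainTheorem18 S lam E inc =
  differenceClosed⇒everything S
    (nuMaximal⇒differenceClosed S lam E
      (strictlyIncreasing-≥suc (nu S lam) (nu0-≥1 S lam E) inc))
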